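{- Let $A$ be an adinkraizable $(n,k)$-chromotopology. Then $A$ has exactly $2^k$ labeled switching classes.
   Context: A chromotopology of dimension $n$ is a finite connected simple bipartite $n$-regular graph with edges colored by $[n]$, each vertex incident to exactly one edge of each color, such that for distinct colors $i,j$ the edges of colors $i,j$ form a disjoint union of $4$-cycles ($2$-colored $4$-cycles). Every chromotopology is isomorphic to a quotient $I^n_c/L$ (vertex set $\mathbf{Z}_2^n/L$, an edge of color $i$ joining $C$ and $C+e_i$) for a unique subspace $L\subseteq\mathbf{Z}_2^n$; it is an $(n,k)$-chromotopology if $\dim L=k$. An odd dashing is a map $d\colon E(A)\to\mathbf{Z}_2$ summing to $1$ over every $2$-colored $4$-cycle. $A$ is adinkraizable if it admits an odd dashing and a ranking (a function $h\colon V\to\mathbf{Z}$ with $|h(u)-h(w)|=1$ on every edge). The vertex switch at $v$ changes $d(e)$ to $d(e)+1$ for every edge $e$ incident to $v$. The labeled switching classes are the orbits of the set of odd dashings under the group generated by all vertex switches. -}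

module Defs where

open import Data.Nat using (ℕ; zero; suc; _<_; _^_)
open import Data.Fin using (Fin; _≟_) renaming (zero to fzero; suc to fsuc)
open import Data.Bool using (Bool; true; false; _xor_; if_then_else_; not; _∨_)
open import Data.Vec using (Vec; []; _∷_)
open import Data.List using (List; []; _∷_; map; _++_; filter; length)
open import Data.Integer using (ℤ; _-_; ∣_∣)
open import Data.Product using (Σ; ∃; _×_; _,_; proj₁)
open import Relation.Binary.PropositionalEquality using (_≡_; _≢_)
open import Relation.Nullary using (¬_)
open import Relation.Nullary.Decidable using (⌊_⌋)

walk : ∀ {n m} → (Fin n → Fin m → Fin m) → Vec Bool n → Fin m → Fin m
walk nb [] v = v
walk nb (b ∷ xs) v =
  let w = walk (λ i → nb (fsuc i)) xs v in if b then nb fzero w else w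

path : ∀ {n m} → (Fin n → Fin m → Fin m) → List (Fin n) → Fin m → Fin m
path nb [] v = v
path nb (i ∷ is) v = path nb is (nb i v)

allVecs : (n : ℕ) → List (Vec Bool n)
allVecs zero = [] ∷ []
allVecs (suc n) = map (false ∷_) (allVecs n) ++ map (true ∷_) (allVecs n)

-- An n-dimensional colored graph on vertex set Fin m, given by the
-- perfect matchings nb i (nb i v = the other endpoint of the unique edge of
-- colour i at v).
record Chromotopology (n m : ℕ) : Set where
  field
    nb         : Fin n → Fin m → Fin m
    nonempty   : 0 < m
    involutive : ∀ i v → nb i (nb i v) ≡ v
    noLoop     : ∀ i v → nb i v ≢ v
    simple     : ∀ i j v → i ≢ j → nb i v ≢ nb j v
    bipartite  : Σ (Fin m → Bool) λ c → ∀ i v → c (nb i v) ≢ c v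
    connected  : ∀ u w → Σ (List (Fin n)) λ is → path nb is u ≡ w
    -- for i ≠ j the edges of colours i, j form disjoint 4-cycles
    twoColour4 : ∀ i j v → i ≢ j → nb j (nb i (nb j (nb i v))) ≡ v

module _ {n m : ℕ} (A : Chromotopology n m) where
  open Chromotopology A

  -- the code L = { x ∈ Z_2^n | walking x from v returns to v }
  codeSize : Fin m → ℕ
  codeSize v = length (filter (λ x → walk nb x v ≟ v) (allVecs n))

  -- A is an (n,k)-chromotopology: L has dimension k, i.e. |L| = 2^k
  -- (L is independent of the base vertex).
  HasCodeDim : ℕ → Set
  HasCodeDim k = ∀ v → codeSize v ≡ 2 ^ k

  -- A function on edges: d i v is the value on the colour-i edge at v.
  record Dashing : Set where
    field
      d    : Fin n → Fin m → Bool
      sym  : ∀ i v → d i (nb i v) ≡ d i v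
  open Dashing public

  IsOdd : Dashing → Set
  IsOdd D = ∀ i j v → i ≢ j →
    ((d D i v xor d D j (nb i v)) xor d D i (nb j (nb i v)))
      xor d D j (nb i (nb j (nb i v))) ≡ true

  IsRanking : (Fin m → ℤ) → Set
  IsRanking h = ∀ i v → ∣ h v - h (nb i v) ∣ ≡ 1

  Adinkraizable : Set
  Adinkraizable = (Σ Dashing IsOdd) × (Σ (Fin m → ℤ) IsRanking)

  switch : Fin m → (Fin n → Fin m → Bool) → (Fin n → Fin m → Bool)
  switch u f i v = if ⌊ v ≟ u ⌋ ∨ ⌊ nb i v ≟ u ⌋ then not (f i v) else f i v

  -- orbit relation of the group generated by vertex switches
  -- (each switch is an involution, so this is the reflexive-transitive
  -- closure of single switches)
  data SwitchEquiv : (Fin n → Fin m → Bool) → (Fin n → Fin m → Bool) → Set where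
    sw-refl : ∀ f → SwitchEquiv f f
    sw-step : ∀ {f g} u → SwitchEquiv (switch u f) g → SwitchEquiv f g

  SameClass : Dashing → Dashing → Set
  SameClass D E = Σ (Fin n → Fin m → Bool) λ g →
    SwitchEquiv (d D) g × (∀ i v → g i v ≡ d E i v)

  NumSwitchingClasses : ℕ → Set
  NumSwitchingClasses N =
    Σ (Fin N → Σ Dashing IsOdd) λ rep →
      (∀ (D : Σ Dashing IsOdd) → ∃ λ j → SameClass (proj₁ D) (proj₁ (rep j)))
      × (∀ j j' → SameClass (proj₁ (rep j)) (proj₁ (rep j')) → j ≡ j')

module Submission where

-- Fix an odd dashing D₀. Every odd dashing is D₀ ⊕ f with f flat (summing to 0 on every
-- 2-coloured 4-cycle), and a vertex switch changes f by a coboundary δp. For a flat f, any word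
-- of colours can be reordered (commuting colours across 4-cycles, cancelling repeated colours)
-- into the normal word of its parity vector without changing its endpoint or its sum along f,
-- so the sum of f around the closed walks at a base vertex v₀ is a character of the code L.
-- This holonomy is invariant under switching, and by connectedness an f with trivial holonomy
-- is a coboundary. Switching classes therefore correspond to the characters of L; there are
-- 2^k of them, each realised as x ↦ x · y by adding the colourwise constant function y to D₀.

open import Defs hiding (sym)
open import Data.Nat using (ℕ; zero; suc; _+_; _^_)
open import Data.Nat.Properties using (+-comm; +-identityʳ; *-cancelˡ-≡; m*n≡1⇒m≡1; m^n≡0⇒m≡0; m^n≡1⇒n≡0∨m≡1)
open import Data.Fin using (Fin; _≟_; combine; remQuot) renaming (zero to fzero; suc to fsuc)
open import Data.Fin.Properties using (remQuot-combine; combine-remQuot; 2↔Bool) renaming (suc-injective to fsuc-injective)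
open import Data.Bool using (Bool; true; false; _xor_; not; _∧_; if_then_else_)
open import Data.Bool.Properties
  using (xor-assoc; xor-comm; xor-same; xor-identityʳ; true-xor; not-distribˡ-xor; ∧-identityʳ; ∧-zeroʳ;
         ∧-distribʳ-xor; xor-∧-commutativeRing)
open import Data.Vec using (Vec; []; _∷_; zipWith; replicate; updateAt; lookup)
open import Data.List using (List; []; _∷_; map; _++_; filter; length; foldr; tabulate; allFin)
open import Data.List.Properties using (filter-++; length-++; filter-≐; filter-none; ++-assoc; ++-identityʳ)
import Data.List.Relation.Unary.All as All
open import Data.Product using (Σ; ∃; _×_; _,_; proj₁; proj₂; uncurry)
open import Data.Sum using (inj₁; inj₂)
open import Data.Empty using (⊥-elim)
open import Function using (_∘_; id)
open import Function.Bundles using (Inverse)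
open import Relation.Binary.PropositionalEquality
open import Relation.Binary.Bundles using (Setoid)
open import Relation.Binary.Structures using (IsEquivalence)
import Relation.Binary.Reasoning.Setoid as SetoidReasoning
open import Relation.Nullary using (¬_; Dec; yes; no; does)
open import Relation.Nullary.Decidable using (⌊_⌋)
open import Relation.Unary using (Decidable; _≐_)
open import Algebra.Bundles using (CommutativeRing)
open import Algebra.Properties.CommutativeSemigroup
  (CommutativeRing.+-commutativeSemigroup xor-∧-commutativeRing) using (interchange)

xor-interchange : ∀ a b c d → (a xor b) xor (c xor d) ≡ (a xor c) xor (b xor d)
xor-interchange = interchange

xor-cancelˡ : ∀ a b → a xor (a xor b) ≡ b
xor-cancelˡ a b = trans (sym (xor-assoc a a b)) (cong (_xor b) (xor-same a))

xor-cancelʳ : ∀ a b → (a xor b) xor b ≡ a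
xor-cancelʳ a b = trans (xor-assoc a b b) (trans (cong (a xor_) (xor-same b)) (xor-identityʳ a))

xor≡false⇒≡ : ∀ {a b} → a xor b ≡ false → a ≡ b
xor≡false⇒≡ {a} {b} e = trans (sym (xor-cancelʳ a b)) (cong (_xor b) e)

infixl 6 _⊕_
_⊕_ : ∀ {n} → Vec Bool n → Vec Bool n → Vec Bool n
_⊕_ = zipWith _xor_

0ᵥ : ∀ {n} → Vec Bool n
0ᵥ = replicate _ false

dot : ∀ {n} → Vec Bool n → Vec Bool n → Bool
dot [] [] = false
dot (a ∷ x) (b ∷ y) = (a ∧ b) xor dot x y

⊕-cancelˡ : ∀ {n} (t x : Vec Bool n) → t ⊕ (t ⊕ x) ≡ x
⊕-cancelˡ [] [] = refl
⊕-cancelˡ (a ∷ t) (b ∷ x) = cong₂ _∷_ (xor-cancelˡ a b) (⊕-cancelˡ t x)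

⊕-self : ∀ {n} (x : Vec Bool n) → x ⊕ x ≡ 0ᵥ
⊕-self []      = refl
⊕-self (a ∷ x) = cong₂ _∷_ (xor-same a) (⊕-self x)

dot-distribʳ-⊕ : ∀ {n} (x x′ y : Vec Bool n) → dot (x ⊕ x′) y ≡ dot x y xor dot x′ y
dot-distribʳ-⊕ [] [] [] = refl
dot-distribʳ-⊕ (a ∷ x) (a′ ∷ x′) (b ∷ y) =
  trans (cong₂ _xor_ (∧-distribʳ-xor b a a′) (dot-distribʳ-⊕ x x′ y))
        (xor-interchange (a ∧ b) (a′ ∧ b) (dot x y) (dot x′ y))

card : ∀ {n} {P : Vec Bool n → Set} → Decidable P → ℕ
card {n} P? = length (filter P? (allVecs n))

length-filter-map : ∀ {A B : Set} {P : B → Set} (P? : Decidable P) (f : A → B) xs →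
  length (filter P? (map f xs)) ≡ length (filter (P? ∘ f) xs)
length-filter-map P? f [] = refl
length-filter-map P? f (x ∷ xs) with does (P? (f x))
... | true  = cong suc (length-filter-map P? f xs)
... | false = length-filter-map P? f xs

card-split : ∀ {n} {P : Vec Bool (suc n) → Set} (P? : Decidable P) →
  card P? ≡ card (P? ∘ (false ∷_)) + card (P? ∘ (true ∷_))
card-split {n} P? = begin
  length (filter P? (map (false ∷_) (allVecs n) ++ map (true ∷_) (allVecs n)))
    ≡⟨ cong length (filter-++ P? (map (false ∷_) (allVecs n)) _) ⟩
  length (filter P? (map (false ∷_) (allVecs n)) ++ filter P? (map (true ∷_) (allVecs n)))
    ≡⟨ length-++ (filter P? (map (false ∷_) (allVecs n))) ⟩
  length (filter P? (map (false ∷_) (allVecs n))) + length (filter P? (map (true ∷_) (allVecs n)))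
    ≡⟨ cong₂ _+_ (length-filter-map P? (false ∷_) (allVecs n)) (length-filter-map P? (true ∷_) (allVecs n)) ⟩
  card (P? ∘ (false ∷_)) + card (P? ∘ (true ∷_)) ∎
  where open ≡-Reasoning

card-translate : ∀ {n} (t : Vec Bool n) {P : Vec Bool n → Set} (P? : Decidable P) →
  card (P? ∘ (t ⊕_)) ≡ card P?
card-translate [] P? with does (P? [])
... | true  = refl
... | false = refl
card-translate (false ∷ t) P? = begin
  card (P? ∘ ((false ∷ t) ⊕_))
    ≡⟨ card-split (P? ∘ ((false ∷ t) ⊕_)) ⟩
  card (P? ∘ (false ∷_) ∘ (t ⊕_)) + card (P? ∘ (true ∷_) ∘ (t ⊕_))
    ≡⟨ cong₂ _+_ (card-translate t (P? ∘ (false ∷_))) (card-translate t (P? ∘ (true ∷_))) ⟩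
  card (P? ∘ (false ∷_)) + card (P? ∘ (true ∷_))
    ≡⟨ card-split P? ⟨
  card P? ∎
  where open ≡-Reasoning
card-translate (true ∷ t) P? = begin
  card (P? ∘ ((true ∷ t) ⊕_))
    ≡⟨ card-split (P? ∘ ((true ∷ t) ⊕_)) ⟩
  card (P? ∘ (true ∷_) ∘ (t ⊕_)) + card (P? ∘ (false ∷_) ∘ (t ⊕_))
    ≡⟨ cong₂ _+_ (card-translate t (P? ∘ (true ∷_))) (card-translate t (P? ∘ (false ∷_))) ⟩
  card (P? ∘ (true ∷_)) + card (P? ∘ (false ∷_))
    ≡⟨ +-comm (card (P? ∘ (true ∷_))) _ ⟩
  card (P? ∘ (false ∷_)) + card (P? ∘ (true ∷_))
    ≡⟨ card-split P? ⟨
  card P? ∎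
  where open ≡-Reasoning

card-≐ : ∀ {n} {P Q : Vec Bool n → Set} (P? : Decidable P) (Q? : Decidable Q) → P ≐ Q → card P? ≡ card Q?
card-≐ {n} P? Q? P≐Q = cong length (filter-≐ P? Q? P≐Q (allVecs n))

card-empty : ∀ {n} {P : Vec Bool n → Set} (P? : Decidable P) → (∀ x → ¬ P x) → card P? ≡ 0
card-empty {n} P? none = cong length (filter-none P? {allVecs n} (All.tabulate λ {x} _ → none x))

∃? : ∀ {n} {P : Vec Bool n → Set} → Decidable P → Dec (∃ P)
∃? {zero} P? with P? []
... | yes p = yes ([] , p)
... | no ¬p = no λ { ([] , p) → ¬p p }
∃? {suc n} P? with ∃? (P? ∘ (false ∷_)) | ∃? (P? ∘ (true ∷_))
... | yes (x , p) | _           = yes (false ∷ x , p)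
... | no _        | yes (x , p) = yes (true ∷ x , p)
... | no ¬p₀      | no ¬p₁      = no λ { (false ∷ x , p) → ¬p₀ (x , p) ; (true ∷ x , p) → ¬p₁ (x , p) }

Closed : ∀ {n} → (Vec Bool n → Set) → Set
Closed P = ∀ x y → P x → P y → P (x ⊕ y)

Additive : ∀ {n} → (Vec Bool n → Set) → (Vec Bool n → Bool) → Set
Additive P φ = ∀ x y → P x → P y → φ (x ⊕ y) ≡ φ x xor φ y

Closed-false : ∀ {n} {P : Vec Bool (suc n) → Set} → Closed P → Closed (P ∘ (false ∷_))
Closed-false closed x y = closed (false ∷ x) (false ∷ y)

Additive-false : ∀ {n} {P : Vec Bool (suc n) → Set} {φ} → Additive P φ → Additive (P ∘ (false ∷_)) (φ ∘ (false ∷_))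
Additive-false additive x y = additive (false ∷ x) (false ∷ y)

record Characters {n} (k : ℕ) (P : Vec Bool n → Set) : Set where
  field
    char     : Fin (2 ^ k) → Vec Bool n
    distinct : ∀ j j′ → (∀ x → P x → dot x (char j) ≡ dot x (char j′)) → j ≡ j′
    complete : ∀ φ → Additive P φ → ∃ λ j → ∀ x → P x → φ x ≡ dot x (char j)
open Characters public

characters-[] : ∀ {P : Vec Bool 0 → Set} → Characters 0 P
characters-[] .char _ = []
characters-[] .distinct fzero fzero _ = refl
characters-[] .complete φ additive = fzero , λ { [] p → trans (additive [] [] p p) (xor-same (φ [])) }

characters-∷false : ∀ {n k} {P : Vec Bool (suc n) → Set} → ¬ ∃ (P ∘ (true ∷_)) →
  Characters k (P ∘ (false ∷_)) → Characters k P
characters-∷false none X .char j = false ∷ char X j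
characters-∷false none X .distinct j j′ same = distinct X j j′ λ x → same (false ∷ x)
characters-∷false {P = P} none X .complete φ additive =
  let j , agree = complete X (φ ∘ (false ∷_)) (Additive-false {φ = φ} additive) in j , agreeP agree
  where
    agreeP : ∀ {y} → (∀ x → P (false ∷ x) → φ (false ∷ x) ≡ dot x y) → ∀ x → P x → φ x ≡ dot x (false ∷ y)
    agreeP agree (false ∷ x) p = agree x p
    agreeP agree (true ∷ x) p = ⊥-elim (none (x , p))

-- A character of P is fixed by its restriction to P ∘ (false ∷_) and its value on true ∷ t.
characters-∷true : ∀ {n k} {P : Vec Bool (suc n) → Set} {t} → P (true ∷ t) → Closed P →
  Characters k (P ∘ (false ∷_)) → Characters (suc k) P
characters-∷true {n} {k} {P} {t} pt closed X = record { char = char′ ; distinct = distinct′ ; complete = complete′ }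
  where
    open Inverse 2↔Bool using (to; from; strictlyInverseˡ; strictlyInverseʳ)
    open ≡-Reasoning

    extend : Fin 2 → Fin (2 ^ k) → Vec Bool (suc n)
    extend b j = (to b xor dot t (char X j)) ∷ char X j

    split : Fin (2 ^ suc k) → Fin 2 × Fin (2 ^ k)
    split = remQuot (2 ^ k)

    char′ : Fin (2 ^ suc k) → Vec Bool (suc n)
    char′ j = uncurry extend (split j)

    extend-injective : ∀ bj bj′ → (∀ x → P x → dot x (uncurry extend bj) ≡ dot x (uncurry extend bj′)) → bj ≡ bj′
    extend-injective (b , j) (b′ , j′) same with distinct X j j′ (λ x → same (false ∷ x))
    ... | refl = cong (_, j) (begin
      b                  ≡⟨ strictlyInverseʳ b ⟨
      from (to b)        ≡⟨ cong from to-b≡to-b′ ⟩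
      from (to b′)       ≡⟨ strictlyInverseʳ b′ ⟩
      b′                 ∎)
      where
        to-b≡to-b′ : to b ≡ to b′
        to-b≡to-b′ = trans (sym (xor-cancelʳ (to b) _)) (trans (same (true ∷ t) pt) (xor-cancelʳ (to b′) _))

    distinct′ : ∀ j j′ → (∀ x → P x → dot x (char′ j) ≡ dot x (char′ j′)) → j ≡ j′
    distinct′ j j′ same = begin
      j                            ≡⟨ combine-remQuot {2} (2 ^ k) j ⟨
      uncurry combine (split j)    ≡⟨ cong (uncurry combine) (extend-injective (split j) (split j′) same) ⟩
      uncurry combine (split j′)   ≡⟨ combine-remQuot {2} (2 ^ k) j′ ⟩
      j′                           ∎

    complete′ : ∀ φ → Additive P φ → ∃ λ j → ∀ x → P x → φ x ≡ dot x (char′ j)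
    complete′ φ additive = combine b j , λ x p →
      trans (agree′ x p) (cong (dot x ∘ uncurry extend) (sym (remQuot-combine b j)))
      where
        j = proj₁ (complete X (φ ∘ (false ∷_)) (Additive-false {φ = φ} additive))
        agree = proj₂ (complete X (φ ∘ (false ∷_)) (Additive-false {φ = φ} additive))
        y = char X j
        B = φ (true ∷ t)
        b = from B
        agree′ : ∀ x → P x → φ x ≡ dot x (extend b j)
        agree′ (false ∷ x) p = agree x p
        agree′ (true ∷ x) p = begin
          φ (true ∷ x)                         ≡⟨ cong (φ ∘ (true ∷_)) (⊕-cancelˡ t x) ⟨
          φ ((true ∷ t) ⊕ (false ∷ (t ⊕ x)))   ≡⟨ additive _ _ pt (closed _ _ pt p) ⟩
          B xor φ (false ∷ (t ⊕ x))            ≡⟨ cong (B xor_) (agree (t ⊕ x) (closed _ _ pt p)) ⟩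
          B xor dot (t ⊕ x) y                  ≡⟨ cong (B xor_) (dot-distribʳ-⊕ t x y) ⟩
          B xor (dot t y xor dot x y)          ≡⟨ xor-assoc B (dot t y) (dot x y) ⟨
          (B xor dot t y) xor dot x y          ≡⟨ cong (λ c → (c xor dot t y) xor dot x y) (strictlyInverseˡ B) ⟨
          (to b xor dot t y) xor dot x y       ∎

double≡2^⇒ : ∀ c k → c + c ≡ 2 ^ k → ∃ λ k′ → k ≡ suc k′ × c ≡ 2 ^ k′
double≡2^⇒ c zero e with m*n≡1⇒m≡1 2 c (trans (cong (c +_) (+-identityʳ c)) e)
... | ()
double≡2^⇒ c (suc k) e = k , refl , *-cancelˡ-≡ c (2 ^ k) 2 (trans (cong (c +_) (+-identityʳ c)) e)

characters : ∀ {n} k {P : Vec Bool n → Set} (P? : Decidable P) → Closed P → card P? ≡ 2 ^ k → Characters k P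
characters {zero} k P? closed size with P? []
... | no _ with m^n≡0⇒m≡0 2 k (sym size)
...   | ()
characters {zero} k P? closed size | yes _ with m^n≡1⇒n≡0∨m≡1 2 k (sym size)
...   | inj₁ refl = characters-[]
...   | inj₂ ()
characters {suc n} k {P} P? closed size with ∃? (P? ∘ (true ∷_))
... | no none = characters-∷false none (characters k (P? ∘ (false ∷_)) (Closed-false closed) size₀)
  where
    size₀ : card (P? ∘ (false ∷_)) ≡ 2 ^ k
    size₀ = begin
      card (P? ∘ (false ∷_))                            ≡⟨ +-identityʳ _ ⟨
      card (P? ∘ (false ∷_)) + 0
        ≡⟨ cong (card (P? ∘ (false ∷_)) +_) (card-empty (P? ∘ (true ∷_)) λ x p → none (x , p)) ⟨
      card (P? ∘ (false ∷_)) + card (P? ∘ (true ∷_))    ≡⟨ card-split P? ⟨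
      card P?                                           ≡⟨ size ⟩
      2 ^ k                                             ∎
      where open ≡-Reasoning
... | yes (t , pt) with double≡2^⇒ (card (P? ∘ (false ∷_))) k double
  where
    -- x ↦ t ⊕ x is a bijection from P ∘ (true ∷_) onto P ∘ (false ∷_)
    halves : card (P? ∘ (true ∷_)) ≡ card (P? ∘ (false ∷_))
    halves = trans (card-≐ (P? ∘ (true ∷_)) (P? ∘ (false ∷_) ∘ (t ⊕_))
                      ((λ {x} p → closed _ _ pt p) , λ {x} q → subst (P ∘ (true ∷_)) (⊕-cancelˡ t x) (closed _ _ pt q)))
                   (card-translate t (P? ∘ (false ∷_)))
    double : card (P? ∘ (false ∷_)) + card (P? ∘ (false ∷_)) ≡ 2 ^ k
    double = trans (cong (card (P? ∘ (false ∷_)) +_) (sym halves)) (trans (sym (card-split P?)) size)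
...   | k′ , refl , size₀ = characters-∷true pt closed (characters k′ (P? ∘ (false ∷_)) (Closed-false closed) size₀)


Involutions : ℕ → ℕ → Set
Involutions n m = Fin n → Fin m → Fin m

EdgeFn : ℕ → ℕ → Set
EdgeFn n m = Fin n → Fin m → Bool

sumAlong : ∀ {n m} → Involutions n m → EdgeFn n m → List (Fin n) → Fin m → Bool
sumAlong nb f []       v = false
sumAlong nb f (i ∷ is) v = f i v xor sumAlong nb f is (nb i v)

square : ∀ {n m} → Involutions n m → EdgeFn n m → Fin n → Fin n → Fin m → Bool
square nb f i j v =
  ((f i v xor f j (nb i v)) xor f i (nb j (nb i v))) xor f j (nb i (nb j (nb i v)))

record Flat {n m} (nb : Involutions n m) (f : EdgeFn n m) : Set where
  field
    involutive : ∀ i v → nb i (nb i v) ≡ v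
    commute    : ∀ i j v → nb i (nb j v) ≡ nb j (nb i v)
    symmetric  : ∀ i v → f i (nb i v) ≡ f i v
    flat       : ∀ i j v → i ≢ j → square nb f i j v ≡ false

Flat-suc : ∀ {n m} {nb : Involutions (suc n) m} {f} → Flat nb f → Flat (nb ∘ fsuc) (f ∘ fsuc)
Flat-suc F = record
  { involutive = involutive ∘ fsuc
  ; commute    = λ i j → commute (fsuc i) (fsuc j)
  ; symmetric  = symmetric ∘ fsuc
  ; flat       = λ i j v i≢j → flat (fsuc i) (fsuc j) v (i≢j ∘ fsuc-injective)
  }
  where open Flat F

flipAt : ∀ {n} → Fin n → Vec Bool n → Vec Bool n
flipAt i x = updateAt x i not

parity : ∀ {n} → List (Fin n) → Vec Bool n
parity []       = 0ᵥ
parity (i ∷ is) = flipAt i (parity is)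

zeroIf : ∀ {n} → Bool → List (Fin (suc n))
zeroIf b = if b then fzero ∷ [] else []

word : ∀ {n} → Vec Bool n → List (Fin n)
word []      = []
word (b ∷ x) = map fsuc (word x) ++ zeroIf b

0ᵥ-⊕ : ∀ {n} (x : Vec Bool n) → 0ᵥ ⊕ x ≡ x
0ᵥ-⊕ []      = refl
0ᵥ-⊕ (b ∷ x) = cong (b ∷_) (0ᵥ-⊕ x)

⊕-0ᵥ : ∀ {n} (x : Vec Bool n) → x ⊕ 0ᵥ ≡ x
⊕-0ᵥ []      = refl
⊕-0ᵥ (b ∷ x) = cong₂ _∷_ (xor-identityʳ b) (⊕-0ᵥ x)

flipAt-⊕ : ∀ {n} (i : Fin n) (x y : Vec Bool n) → flipAt i x ⊕ y ≡ flipAt i (x ⊕ y)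
flipAt-⊕ fzero    (a ∷ x) (b ∷ y) = cong (_∷ (x ⊕ y)) (sym (not-distribˡ-xor a b))
flipAt-⊕ (fsuc i) (a ∷ x) (b ∷ y) = cong ((a xor b) ∷_) (flipAt-⊕ i x y)

parity-++ : ∀ {n} (xs ys : List (Fin n)) → parity (xs ++ ys) ≡ parity xs ⊕ parity ys
parity-++ []       ys = sym (0ᵥ-⊕ (parity ys))
parity-++ (i ∷ xs) ys = trans (cong (flipAt i) (parity-++ xs ys)) (sym (flipAt-⊕ i (parity xs) (parity ys)))

parity-map-suc : ∀ {n} (is : List (Fin n)) → parity (map fsuc is) ≡ false ∷ parity is
parity-map-suc []       = refl
parity-map-suc (i ∷ is) = cong (flipAt (fsuc i)) (parity-map-suc is)

parity-word : ∀ {n} (x : Vec Bool n) → parity (word x) ≡ x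
parity-word []      = refl
parity-word (b ∷ x) = begin
  parity (map fsuc (word x) ++ zeroIf b)          ≡⟨ parity-++ (map fsuc (word x)) (zeroIf b) ⟩
  parity (map fsuc (word x)) ⊕ parity (zeroIf b)  ≡⟨ cong (_⊕ parity (zeroIf b)) (parity-map-suc (word x)) ⟩
  (false ∷ parity (word x)) ⊕ parity (zeroIf b)   ≡⟨ cong (λ y → (false ∷ y) ⊕ parity (zeroIf b)) (parity-word x) ⟩
  (false ∷ x) ⊕ parity (zeroIf b)                 ≡⟨ lastBit b ⟩
  b ∷ x                                           ∎
  where
    open ≡-Reasoning
    lastBit : ∀ b → (false ∷ x) ⊕ parity (zeroIf b) ≡ b ∷ x
    lastBit false = cong (false ∷_) (⊕-0ᵥ x)
    lastBit true  = cong (true ∷_) (⊕-0ᵥ x)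

word-0ᵥ : ∀ {n} → word (0ᵥ {n}) ≡ []
word-0ᵥ {zero}  = refl
word-0ᵥ {suc n} = trans (++-identityʳ _) (cong (map fsuc) (word-0ᵥ {n}))

path-++ : ∀ {n m} (nb : Involutions n m) xs ys v → path nb (xs ++ ys) v ≡ path nb ys (path nb xs v)
path-++ nb []       ys v = refl
path-++ nb (i ∷ xs) ys v = path-++ nb xs ys (nb i v)

sumAlong-++ : ∀ {n m} (nb : Involutions n m) f xs ys v →
  sumAlong nb f (xs ++ ys) v ≡ sumAlong nb f xs v xor sumAlong nb f ys (path nb xs v)
sumAlong-++ nb f []       ys v = refl
sumAlong-++ nb f (i ∷ xs) ys v =
  trans (cong (f i v xor_) (sumAlong-++ nb f xs ys (nb i v))) (sym (xor-assoc (f i v) _ _))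

path-map-suc : ∀ {n m} (nb : Involutions (suc n) m) is v → path nb (map fsuc is) v ≡ path (nb ∘ fsuc) is v
path-map-suc nb []       v = refl
path-map-suc nb (i ∷ is) v = path-map-suc nb is (nb (fsuc i) v)

sumAlong-map-suc : ∀ {n m} (nb : Involutions (suc n) m) f is v →
  sumAlong nb f (map fsuc is) v ≡ sumAlong (nb ∘ fsuc) (f ∘ fsuc) is v
sumAlong-map-suc nb f []       v = refl
sumAlong-map-suc nb f (i ∷ is) v = cong (f (fsuc i) v xor_) (sumAlong-map-suc nb f is (nb (fsuc i) v))

walk-word : ∀ {n m} (nb : Involutions n m) x v → walk nb x v ≡ path nb (word x) v
walk-word nb []      v = refl
walk-word nb (b ∷ x) v = begin
  (if b then nb fzero w else w)                         ≡⟨ lastStep b ⟩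
  path nb (zeroIf b) (path (nb ∘ fsuc) (word x) v)      ≡⟨ cong (path nb (zeroIf b)) (path-map-suc nb (word x) v) ⟨
  path nb (zeroIf b) (path nb (map fsuc (word x)) v)    ≡⟨ path-++ nb (map fsuc (word x)) (zeroIf b) v ⟨
  path nb (word (b ∷ x)) v                              ∎
  where
    open ≡-Reasoning
    w = walk (nb ∘ fsuc) x v
    lastStep : ∀ b → (if b then nb fzero w else w) ≡ path nb (zeroIf b) (path (nb ∘ fsuc) (word x) v)
    lastStep false = walk-word (nb ∘ fsuc) x v
    lastStep true  = cong (nb fzero) (walk-word (nb ∘ fsuc) x v)

infix 4 _≈[_,_]_
record _≈[_,_]_ {n m} (xs : List (Fin n)) (nb : Involutions n m) (f : EdgeFn n m) (ys : List (Fin n)) : Set where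
  constructor equivalent
  field at : ∀ v → path nb xs v ≡ path nb ys v × sumAlong nb f xs v ≡ sumAlong nb f ys v
open _≈[_,_]_ public

module _ {n m} {nb : Involutions n m} {f : EdgeFn n m} where

  ≈-isEquivalence : IsEquivalence (λ xs ys → xs ≈[ nb , f ] ys)
  ≈-isEquivalence = record
    { refl  = equivalent λ v → refl , refl
    ; sym   = λ e → equivalent λ v → sym (proj₁ (at e v)) , sym (proj₂ (at e v))
    ; trans = λ e e′ → equivalent λ v →
        trans (proj₁ (at e v)) (proj₁ (at e′ v)) , trans (proj₂ (at e v)) (proj₂ (at e′ v))
    }

  ≈-setoid : Setoid _ _
  ≈-setoid = record { isEquivalence = ≈-isEquivalence }

  ≈-reflexive : ∀ {xs ys} → xs ≡ ys → xs ≈[ nb , f ] ys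
  ≈-reflexive refl = equivalent λ v → refl , refl

  ≈-++ˡ : ∀ zs {xs ys} → xs ≈[ nb , f ] ys → zs ++ xs ≈[ nb , f ] zs ++ ys
  ≈-++ˡ zs {xs} {ys} e = equivalent λ v →
    trans (path-++ nb zs xs v) (trans (proj₁ (at e (path nb zs v))) (sym (path-++ nb zs ys v))) ,
    trans (sumAlong-++ nb f zs xs v)
      (trans (cong (sumAlong nb f zs v xor_) (proj₂ (at e (path nb zs v)))) (sym (sumAlong-++ nb f zs ys v)))

  ≈-++ʳ : ∀ zs {xs ys} → xs ≈[ nb , f ] ys → xs ++ zs ≈[ nb , f ] ys ++ zs
  ≈-++ʳ zs {xs} {ys} e = equivalent λ v →
    trans (path-++ nb xs zs v) (trans (cong (path nb zs) (proj₁ (at e v))) (sym (path-++ nb ys zs v))) ,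
    trans (sumAlong-++ nb f xs zs v)
      (trans (cong₂ (λ s w → s xor sumAlong nb f zs w) (proj₂ (at e v)) (proj₁ (at e v))) (sym (sumAlong-++ nb f ys zs v)))

≈-map-suc : ∀ {n m} {nb : Involutions (suc n) m} {f : EdgeFn (suc n) m} {xs ys} →
  xs ≈[ nb ∘ fsuc , f ∘ fsuc ] ys → map fsuc xs ≈[ nb , f ] map fsuc ys
≈-map-suc {nb = nb} {f} {xs} {ys} e = equivalent λ v →
  trans (path-map-suc nb xs v) (trans (proj₁ (at e v)) (sym (path-map-suc nb ys v))) ,
  trans (sumAlong-map-suc nb f xs v) (trans (proj₂ (at e v)) (sym (sumAlong-map-suc nb f ys v)))

module _ {n m} {nb : Involutions n m} {f : EdgeFn n m} (F : Flat nb f) where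
  open Flat F

  ≈-swap : ∀ {i j} → i ≢ j → i ∷ j ∷ [] ≈[ nb , f ] j ∷ i ∷ []
  ≈-swap {i} {j} i≢j = equivalent λ v → commute j i v , sums v
    where
      -- With commute, involutive and symmetric, the square through v compares the two
      -- two-step paths i j and j i from v.
      sums : ∀ v → f i v xor (f j (nb i v) xor false) ≡ f j v xor (f i (nb j v) xor false)
      sums v = begin
        e₁ xor (e₂ xor false)   ≡⟨ cong (e₁ xor_) (xor-identityʳ e₂) ⟩
        e₁ xor e₂               ≡⟨ xor≡false⇒≡ around ⟩
        e₃ xor e₄               ≡⟨ xor-comm e₃ e₄ ⟩
        e₄ xor e₃               ≡⟨ cong (e₄ xor_) (xor-identityʳ e₃) ⟨
        e₄ xor (e₃ xor false)   ∎
        where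
          open ≡-Reasoning
          e₁ = f i v
          e₂ = f j (nb i v)
          e₃ = f i (nb j v)
          e₄ = f j v
          third : f i (nb j (nb i v)) ≡ e₃
          third = trans (cong (f i) (commute j i v)) (symmetric i (nb j v))
          fourth : f j (nb i (nb j (nb i v))) ≡ e₄
          fourth = trans (cong (f j ∘ nb i) (commute j i v))
                         (trans (cong (f j) (involutive i (nb j v))) (symmetric j v))
          around : (e₁ xor e₂) xor (e₃ xor e₄) ≡ false
          around = trans (sym (xor-assoc (e₁ xor e₂) e₃ e₄))
                         (trans (cong₂ (λ x y → ((e₁ xor e₂) xor x) xor y) (sym third) (sym fourth)) (flat i j v i≢j))

  ≈-cancel : ∀ i → i ∷ i ∷ [] ≈[ nb , f ] []
  ≈-cancel i = equivalent λ v → involutive i v ,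
    trans (cong (λ s → f i v xor (s xor false)) (symmetric i v)) (xor-cancelˡ (f i v) false)

≈-move-zero : ∀ {n m} {nb : Involutions (suc n) m} {f : EdgeFn (suc n) m} → Flat nb f →
  ∀ is → fzero ∷ map fsuc is ≈[ nb , f ] map fsuc is ++ fzero ∷ []
≈-move-zero F []       = equivalent λ v → refl , refl
≈-move-zero {nb = nb} {f} F (j ∷ is) = begin
  fzero ∷ fsuc j ∷ map fsuc is            ≈⟨ ≈-++ʳ (map fsuc is) (≈-swap F {fzero} {fsuc j} λ ()) ⟩
  fsuc j ∷ fzero ∷ map fsuc is            ≈⟨ ≈-++ˡ (fsuc j ∷ []) (≈-move-zero F is) ⟩
  fsuc j ∷ (map fsuc is ++ fzero ∷ [])    ∎
  where open SetoidReasoning (≈-setoid {nb = nb} {f})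

≈-flipAt : ∀ {n m} {nb : Involutions n m} {f : EdgeFn n m} → Flat nb f →
  ∀ i x → i ∷ word x ≈[ nb , f ] word (flipAt i x)
≈-flipAt F (fsuc i) (b ∷ x) = ≈-++ʳ (zeroIf b) (≈-map-suc (≈-flipAt (Flat-suc F) i x))
≈-flipAt {nb = nb} {f} F fzero (false ∷ x) = begin
  fzero ∷ (map fsuc (word x) ++ [])    ≡⟨ cong (fzero ∷_) (++-identityʳ _) ⟩
  fzero ∷ map fsuc (word x)            ≈⟨ ≈-move-zero F (word x) ⟩
  map fsuc (word x) ++ fzero ∷ []      ∎
  where open SetoidReasoning (≈-setoid {nb = nb} {f})
≈-flipAt {nb = nb} {f} F fzero (true ∷ x) = begin
  fzero ∷ (map fsuc (word x) ++ fzero ∷ [])        ≈⟨ ≈-++ʳ (fzero ∷ []) (≈-move-zero F (word x)) ⟩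
  (map fsuc (word x) ++ fzero ∷ []) ++ fzero ∷ []  ≡⟨ ++-assoc (map fsuc (word x)) (fzero ∷ []) (fzero ∷ []) ⟩
  map fsuc (word x) ++ fzero ∷ fzero ∷ []          ≈⟨ ≈-++ˡ (map fsuc (word x)) (≈-cancel F fzero) ⟩
  map fsuc (word x) ++ []                          ∎
  where open SetoidReasoning (≈-setoid {nb = nb} {f})

≈-word-parity : ∀ {n m} {nb : Involutions n m} {f : EdgeFn n m} → Flat nb f →
  ∀ is → is ≈[ nb , f ] word (parity is)
≈-word-parity F []       = ≈-reflexive (sym word-0ᵥ)
≈-word-parity {nb = nb} {f} F (i ∷ is) = begin
  i ∷ is                        ≈⟨ ≈-++ˡ (i ∷ []) (≈-word-parity F is) ⟩
  i ∷ word (parity is)          ≈⟨ ≈-flipAt F i (parity is) ⟩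
  word (flipAt i (parity is))   ∎
  where open SetoidReasoning (≈-setoid {nb = nb} {f})

≈-of-parity : ∀ {n m} {nb : Involutions n m} {f : EdgeFn n m} → Flat nb f →
  ∀ {xs ys} → parity xs ≡ parity ys → xs ≈[ nb , f ] ys
≈-of-parity {nb = nb} {f} F {xs} {ys} same = begin
  xs                  ≈⟨ ≈-word-parity F xs ⟩
  word (parity xs)    ≡⟨ cong word same ⟩
  word (parity ys)    ≈⟨ ≈-word-parity F ys ⟨
  ys                  ∎
  where open SetoidReasoning (≈-setoid {nb = nb} {f})

≈-twice : ∀ {n m} {nb : Involutions n m} {f : EdgeFn n m} → Flat nb f → ∀ is → is ++ is ≈[ nb , f ] []
≈-twice F is = ≈-of-parity F (trans (parity-++ is is) (⊕-self (parity is)))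

word-⊕ : ∀ {n m} {nb : Involutions n m} {f : EdgeFn n m} → Flat nb f →
  ∀ x y → word (x ⊕ y) ≈[ nb , f ] word x ++ word y
word-⊕ F x y = ≈-of-parity F (begin
  parity (word (x ⊕ y))                ≡⟨ parity-word (x ⊕ y) ⟩
  x ⊕ y                                ≡⟨ cong₂ _⊕_ (parity-word x) (parity-word y) ⟨
  parity (word x) ⊕ parity (word y)    ≡⟨ parity-++ (word x) (word y) ⟨
  parity (word x ++ word y)            ∎)
  where open ≡-Reasoning

infixl 6 _⊕ₑ_
_⊕ₑ_ : ∀ {n m} → EdgeFn n m → EdgeFn n m → EdgeFn n m
(f ⊕ₑ g) i v = f i v xor g i v

δ : ∀ {n m} → Involutions n m → (Fin m → Bool) → EdgeFn n m
δ nb p i v = p v xor p (nb i v)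

module _ {n m} (nb : Involutions n m) where

  square-⊕ₑ : ∀ f g i j v → square nb (f ⊕ₑ g) i j v ≡ square nb f i j v xor square nb g i j v
  square-⊕ₑ f g i j v = begin
    (((a₁ xor b₁) xor (a₂ xor b₂)) xor (a₃ xor b₃)) xor (a₄ xor b₄)
      ≡⟨ cong (λ s → (s xor (a₃ xor b₃)) xor (a₄ xor b₄)) (xor-interchange a₁ b₁ a₂ b₂) ⟩
    (((a₁ xor a₂) xor (b₁ xor b₂)) xor (a₃ xor b₃)) xor (a₄ xor b₄)
      ≡⟨ cong (_xor (a₄ xor b₄)) (xor-interchange (a₁ xor a₂) (b₁ xor b₂) a₃ b₃) ⟩
    (((a₁ xor a₂) xor a₃) xor ((b₁ xor b₂) xor b₃)) xor (a₄ xor b₄)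
      ≡⟨ xor-interchange ((a₁ xor a₂) xor a₃) ((b₁ xor b₂) xor b₃) a₄ b₄ ⟩
    square nb f i j v xor square nb g i j v
      ∎
    where
      open ≡-Reasoning
      v₂ = nb i v
      v₃ = nb j v₂
      v₄ = nb i v₃
      a₁ = f i v ; a₂ = f j v₂ ; a₃ = f i v₃ ; a₄ = f j v₄
      b₁ = g i v ; b₂ = g j v₂ ; b₃ = g i v₃ ; b₄ = g j v₄

  sumAlong-⊕ₑ : ∀ f g is v → sumAlong nb (f ⊕ₑ g) is v ≡ sumAlong nb f is v xor sumAlong nb g is v
  sumAlong-⊕ₑ f g []       v = refl
  sumAlong-⊕ₑ f g (i ∷ is) v =
    trans (cong ((f i v xor g i v) xor_) (sumAlong-⊕ₑ f g is (nb i v)))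
      (xor-interchange (f i v) (g i v) (sumAlong nb f is (nb i v)) (sumAlong nb g is (nb i v)))

  sumAlong-cong : ∀ {f g} → (∀ i v → f i v ≡ g i v) → ∀ is v → sumAlong nb f is v ≡ sumAlong nb g is v
  sumAlong-cong f≗g []       v = refl
  sumAlong-cong f≗g (i ∷ is) v = cong₂ _xor_ (f≗g i v) (sumAlong-cong f≗g is (nb i v))

  sumAlong-δ : ∀ p is v → sumAlong nb (δ nb p) is v ≡ p v xor p (path nb is v)
  sumAlong-δ p []       v = sym (xor-same (p v))
  sumAlong-δ p (i ∷ is) v = begin
    (p v xor p (nb i v)) xor sumAlong nb (δ nb p) is (nb i v)   ≡⟨ cong ((p v xor p (nb i v)) xor_) (sumAlong-δ p is (nb i v)) ⟩
    (p v xor p (nb i v)) xor (p (nb i v) xor p w)               ≡⟨ xor-assoc (p v) _ _ ⟩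
    p v xor (p (nb i v) xor (p (nb i v) xor p w))               ≡⟨ cong (p v xor_) (xor-cancelˡ (p (nb i v)) (p w)) ⟩
    p v xor p w                                                 ∎
    where
      open ≡-Reasoning
      w = path nb is (nb i v)

  sumAlong-⊕ₑ-δ-loop : ∀ f p is v → path nb is v ≡ v → sumAlong nb (f ⊕ₑ δ nb p) is v ≡ sumAlong nb f is v
  sumAlong-⊕ₑ-δ-loop f p is v loop = begin
    sumAlong nb (f ⊕ₑ δ nb p) is v                       ≡⟨ sumAlong-⊕ₑ f (δ nb p) is v ⟩
    sumAlong nb f is v xor sumAlong nb (δ nb p) is v     ≡⟨ cong (sumAlong nb f is v xor_) (sumAlong-δ p is v) ⟩
    sumAlong nb f is v xor (p v xor p (path nb is v))    ≡⟨ cong (λ w → sumAlong nb f is v xor (p v xor p w)) loop ⟩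
    sumAlong nb f is v xor (p v xor p v)                 ≡⟨ cong (sumAlong nb f is v xor_) (xor-same (p v)) ⟩
    sumAlong nb f is v xor false                         ≡⟨ xor-identityʳ _ ⟩
    sumAlong nb f is v                                   ∎
    where open ≡-Reasoning

colourwise : ∀ {n m} → Vec Bool n → EdgeFn n m
colourwise y i _ = lookup y i

sumAlong-colourwise : ∀ {n m} (nb : Involutions n m) y x v → sumAlong nb (colourwise y) (word x) v ≡ dot x y
sumAlong-colourwise nb []      []      v = refl
sumAlong-colourwise nb (c ∷ y) (b ∷ x) v = begin
  sumAlong nb e (map fsuc (word x) ++ zeroIf b) v
    ≡⟨ sumAlong-++ nb e (map fsuc (word x)) (zeroIf b) v ⟩
  sumAlong nb e (map fsuc (word x)) v xor sumAlong nb e (zeroIf b) _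
    ≡⟨ cong (_xor sumAlong nb e (zeroIf b) _) (sumAlong-map-suc nb e (word x) v) ⟩
  sumAlong (nb ∘ fsuc) (colourwise y) (word x) v xor sumAlong nb e (zeroIf b) _
    ≡⟨ cong (_xor sumAlong nb e (zeroIf b) _) (sumAlong-colourwise (nb ∘ fsuc) y x v) ⟩
  dot x y xor sumAlong nb e (zeroIf b) _
    ≡⟨ lastBit b ⟩
  (b ∧ c) xor dot x y
    ∎
  where
    open ≡-Reasoning
    e = colourwise (c ∷ y)
    lastBit : ∀ b {w} → dot x y xor sumAlong nb e (zeroIf b) w ≡ (b ∧ c) xor dot x y
    lastBit false = xor-identityʳ (dot x y)
    lastBit true  = trans (cong (dot x y xor_) (xor-identityʳ c)) (xor-comm (dot x y) c)

point : ∀ {m} → Fin m → Fin m → Bool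
point u w = ⌊ w ≟ u ⌋

indicator : ∀ {m} → (Fin m → Bool) → List (Fin m) → Fin m → Bool
indicator p us w = foldr (λ u s → (p u ∧ point u w) xor s) false us

point-suc : ∀ {m} (u w : Fin m) → point (fsuc u) (fsuc w) ≡ point u w
point-suc u w with w ≟ u
... | yes _ = refl
... | no _  = refl

indicator-tabulate-suc : ∀ {k m} (p : Fin (suc m) → Bool) (g : Fin k → Fin m) w →
  indicator p (tabulate (fsuc ∘ g)) (fsuc w) ≡ indicator (p ∘ fsuc) (tabulate g) w
indicator-tabulate-suc {zero}  p g w = refl
indicator-tabulate-suc {suc k} p g w =
  cong₂ (λ a s → (p (fsuc (g fzero)) ∧ a) xor s) (point-suc (g fzero) w) (indicator-tabulate-suc p (g ∘ fsuc) w)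

indicator-tabulate-zero : ∀ {k m} (p : Fin (suc m) → Bool) (g : Fin k → Fin m) →
  indicator p (tabulate (fsuc ∘ g)) fzero ≡ false
indicator-tabulate-zero {zero}  p g = refl
indicator-tabulate-zero {suc k} p g =
  cong₂ _xor_ (∧-zeroʳ (p (fsuc (g fzero)))) (indicator-tabulate-zero p (g ∘ fsuc))

indicator-allFin : ∀ {m} (p : Fin m → Bool) w → indicator p (allFin m) w ≡ p w
indicator-allFin {suc m} p fzero =
  trans (cong₂ _xor_ (∧-identityʳ (p fzero)) (indicator-tabulate-zero p id)) (xor-identityʳ (p fzero))
indicator-allFin {suc m} p (fsuc w) =
  trans (cong₂ _xor_ (∧-zeroʳ (p fzero)) (indicator-tabulate-suc p id w)) (indicator-allFin (p ∘ fsuc) w)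

module Classification {n m} (A : Chromotopology n m) (v₀ : Fin m) where
  open Chromotopology A

  commute : ∀ i j v → nb i (nb j v) ≡ nb j (nb i v)
  commute i j v with i ≟ j
  ... | yes refl = refl
  ... | no i≢j = begin
    nb i (nb j v)                         ≡⟨ involutive j _ ⟨
    nb j (nb j (nb i (nb j v)))           ≡⟨ cong (nb j) (involutive i _) ⟨
    nb j (nb i (nb i (nb j (nb i (nb j v))))) ≡⟨ cong (nb j ∘ nb i) (twoColour4 j i v (i≢j ∘ sym)) ⟩
    nb j (nb i v)                         ∎
    where open ≡-Reasoning

  mkFlat : ∀ {f} → (∀ i v → f i (nb i v) ≡ f i v) → (∀ i j v → i ≢ j → square nb f i j v ≡ false) → Flat nb f
  mkFlat symmetric squares = record
    { involutive = involutive ; commute = commute ; symmetric = symmetric ; flat = squares }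

  Flat-zero : Flat nb (λ _ _ → false)
  Flat-zero = mkFlat (λ _ _ → refl) (λ _ _ _ _ → refl)

  Flat-colourwise : ∀ y → Flat nb (colourwise y)
  Flat-colourwise y = mkFlat (λ _ _ → refl) λ i j v _ →
    trans (xor-assoc (lookup y i xor lookup y j) (lookup y i) (lookup y j)) (xor-same (lookup y i xor lookup y j))

  Flat-difference : ∀ {D E} → IsOdd A D → IsOdd A E → Flat nb (d D ⊕ₑ d E)
  Flat-difference {D} {E} oddD oddE =
    mkFlat (λ i v → cong₂ _xor_ (Dashing.sym D i v) (Dashing.sym E i v))
         (λ i j v i≢j → trans (square-⊕ₑ nb (d D) (d E) i j v) (cong₂ _xor_ (oddD i j v i≢j) (oddE i j v i≢j)))

  twist : (D : Dashing A) (g : EdgeFn n m) → Flat nb g → Dashing A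
  twist D g G .d = d D ⊕ₑ g
  twist D g G .Dashing.sym i v = cong₂ _xor_ (Dashing.sym D i v) (Flat.symmetric G i v)

  twist-odd : ∀ {D g} → IsOdd A D → (G : Flat nb g) → IsOdd A (twist D g G)
  twist-odd {D} {g} oddD G i j v i≢j =
    trans (square-⊕ₑ nb (d D) g i j v) (cong₂ _xor_ (oddD i j v i≢j) (Flat.flat G i j v i≢j))

  Code : Vec Bool n → Set
  Code x = walk nb x v₀ ≡ v₀

  code? : Decidable Code
  code? x = walk nb x v₀ ≟ v₀

  walk-⊕ : ∀ x y v → walk nb (x ⊕ y) v ≡ walk nb y (walk nb x v)
  walk-⊕ x y v = begin
    walk nb (x ⊕ y) v                     ≡⟨ walk-word nb (x ⊕ y) v ⟩
    path nb (word (x ⊕ y)) v              ≡⟨ proj₁ (at (word-⊕ Flat-zero x y) v) ⟩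
    path nb (word x ++ word y) v          ≡⟨ path-++ nb (word x) (word y) v ⟩
    path nb (word y) (path nb (word x) v) ≡⟨ walk-word nb y _ ⟨
    walk nb y (path nb (word x) v)        ≡⟨ cong (walk nb y) (walk-word nb x v) ⟨
    walk nb y (walk nb x v)               ∎
    where open ≡-Reasoning

  Code-closed : Closed Code
  Code-closed x y cx cy = trans (walk-⊕ x y v₀) (trans (cong (walk nb y) cx) cy)

  holonomy : EdgeFn n m → Vec Bool n → Bool
  holonomy f x = sumAlong nb f (word x) v₀

  holonomy-additive : ∀ {f} → Flat nb f → Additive Code (holonomy f)
  holonomy-additive {f} F x y cx cy = begin
    sumAlong nb f (word (x ⊕ y)) v₀                                   ≡⟨ proj₂ (at (word-⊕ F x y) v₀) ⟩
    sumAlong nb f (word x ++ word y) v₀                               ≡⟨ sumAlong-++ nb f (word x) (word y) v₀ ⟩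
    holonomy f x xor sumAlong nb f (word y) (path nb (word x) v₀)
      ≡⟨ cong (λ w → holonomy f x xor sumAlong nb f (word y) w) x-returns ⟩
    holonomy f x xor holonomy f y                                     ∎
    where
      open ≡-Reasoning
      x-returns : path nb (word x) v₀ ≡ v₀
      x-returns = trans (sym (walk-word nb x v₀)) cx

  switch-≗ : ∀ u f i v → switch A u f i v ≡ (f ⊕ₑ δ nb (point u)) i v
  switch-≗ u f i v with v ≟ u | nb i v ≟ u
  ... | yes v≡u | yes nbv≡u = ⊥-elim (noLoop i v (trans nbv≡u (sym v≡u)))
  ... | yes _   | no _      = sym (trans (xor-comm (f i v) true) (true-xor (f i v)))
  ... | no _    | yes _     = sym (trans (xor-comm (f i v) true) (true-xor (f i v)))
  ... | no _    | no _      = sym (xor-identityʳ (f i v))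

  sumAlong-switch : ∀ u f is v → path nb is v ≡ v → sumAlong nb (switch A u f) is v ≡ sumAlong nb f is v
  sumAlong-switch u f is v loop =
    trans (sumAlong-cong nb (switch-≗ u f) is v) (sumAlong-⊕ₑ-δ-loop nb f (point u) is v loop)

  sumAlong-SwitchEquiv : ∀ {f g} → SwitchEquiv A f g → ∀ is v → path nb is v ≡ v →
    sumAlong nb g is v ≡ sumAlong nb f is v
  sumAlong-SwitchEquiv (sw-refl f)      is v loop = refl
  sumAlong-SwitchEquiv (sw-step {f} u r) is v loop =
    trans (sumAlong-SwitchEquiv r is v loop) (sumAlong-switch u f is v loop)

  switchWhere : (Fin m → Bool) → List (Fin m) → EdgeFn n m → EdgeFn n m
  switchWhere p []       f = f
  switchWhere p (u ∷ us) f = switchWhere p us (if p u then switch A u f else f)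

  SwitchEquiv-switchWhere : ∀ p us f → SwitchEquiv A f (switchWhere p us f)
  SwitchEquiv-switchWhere p []       f = sw-refl f
  SwitchEquiv-switchWhere p (u ∷ us) f with p u
  ... | true  = sw-step u (SwitchEquiv-switchWhere p us (switch A u f))
  ... | false = SwitchEquiv-switchWhere p us f

  switchWhere-≗ : ∀ p us f i v → switchWhere p us f i v ≡ (f ⊕ₑ δ nb (indicator p us)) i v
  switchWhere-≗ p []       f i v = sym (xor-identityʳ (f i v))
  switchWhere-≗ p (u ∷ us) f i v with p u
  ... | false = switchWhere-≗ p us f i v
  ... | true  = begin
    switchWhere p us (switch A u f) i v                    ≡⟨ switchWhere-≗ p us (switch A u f) i v ⟩
    switch A u f i v xor δ nb (indicator p us) i v         ≡⟨ cong (_xor δ nb (indicator p us) i v) (switch-≗ u f i v) ⟩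
    (f i v xor δ nb (point u) i v) xor δ nb (indicator p us) i v
                                                           ≡⟨ xor-assoc (f i v) _ _ ⟩
    f i v xor (δ nb (point u) i v xor δ nb (indicator p us) i v)
                                                           ≡⟨ cong (f i v xor_) (xor-interchange (point u v) _ _ _) ⟩
    f i v xor ((point u v xor indicator p us v) xor (point u (nb i v) xor indicator p us (nb i v)))
                                                           ∎
    where open ≡-Reasoning

  route : Fin m → List (Fin n)
  route w = proj₁ (connected v₀ w)

  route-ends : ∀ w → path nb (route w) v₀ ≡ w
  route-ends w = proj₂ (connected v₀ w)

  Vanishes : EdgeFn n m → Set
  Vanishes f = ∀ x → Code x → holonomy f x ≡ false

  sumAlong-loop : ∀ {f} → Flat nb f → Vanishes f → ∀ is → path nb is v₀ ≡ v₀ → sumAlong nb f is v₀ ≡ false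
  sumAlong-loop F vanishes is loop =
    trans (proj₂ (at (≈-word-parity F is) v₀))
          (vanishes (parity is) (trans (walk-word nb (parity is) v₀)
                                  (trans (sym (proj₁ (at (≈-word-parity F is) v₀))) loop)))

  potential : EdgeFn n m → Fin m → Bool
  potential f w = sumAlong nb f (route w) v₀

  -- route w, then edge i, then route (nb i w) once more is a loop at v₀, since a word
  -- walked twice returns to its start (≈-twice).
  coboundary : ∀ {f} → Flat nb f → Vanishes f → ∀ i w → f i w ≡ δ nb (potential f) i w
  coboundary {f} F vanishes i w =
    trans (sym (xor-cancelʳ (f i w) (potential f (nb i w))))
          (cong (_xor potential f (nb i w)) (sym (xor≡false⇒≡ {potential f w} loop-sum)))
    where
      back = route (nb i w)
      twice = at (≈-twice F back) v₀
      back-ends : path nb back (nb i w) ≡ v₀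
      back-ends = trans (cong (path nb back) (sym (route-ends (nb i w))))
                        (trans (sym (path-++ nb back back v₀)) (proj₁ twice))
      back-sum : sumAlong nb f back (nb i w) ≡ potential f (nb i w)
      back-sum = sym (trans (xor≡false⇒≡ (trans (sym (sumAlong-++ nb f back back v₀)) (proj₂ twice)))
                            (cong (sumAlong nb f back) (route-ends (nb i w))))
      loop = route w ++ i ∷ back
      loop-ends : path nb loop v₀ ≡ v₀
      loop-ends = trans (path-++ nb (route w) (i ∷ back) v₀)
                        (trans (cong (path nb back ∘ nb i) (route-ends w)) back-ends)
      loop-sum : potential f w xor (f i w xor potential f (nb i w)) ≡ false
      loop-sum = begin
        potential f w xor (f i w xor potential f (nb i w))         ≡⟨ cong (λ s → potential f w xor (f i w xor s)) back-sum ⟨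
        potential f w xor (f i w xor sumAlong nb f back (nb i w))
          ≡⟨ cong (λ u → potential f w xor (f i u xor sumAlong nb f back (nb i u))) (route-ends w) ⟨
        potential f w xor sumAlong nb f (i ∷ back) (path nb (route w) v₀)
          ≡⟨ sumAlong-++ nb f (route w) (i ∷ back) v₀ ⟨
        sumAlong nb f loop v₀                                      ≡⟨ sumAlong-loop F vanishes loop loop-ends ⟩
        false                                                      ∎
        where open ≡-Reasoning

  SameClass-of-Vanishes : ∀ {D E} → IsOdd A D → IsOdd A E → Vanishes (d D ⊕ₑ d E) → SameClass A D E
  SameClass-of-Vanishes {D} {E} oddD oddE vanishes =
    switchWhere p (allFin m) (d D) , SwitchEquiv-switchWhere p (allFin m) (d D) , agrees
    where
      p = potential (d D ⊕ₑ d E)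
      agrees : ∀ i v → switchWhere p (allFin m) (d D) i v ≡ d E i v
      agrees i v = begin
        switchWhere p (allFin m) (d D) i v               ≡⟨ switchWhere-≗ p (allFin m) (d D) i v ⟩
        d D i v xor δ nb (indicator p (allFin m)) i v
          ≡⟨ cong₂ (λ a b → d D i v xor (a xor b)) (indicator-allFin p v) (indicator-allFin p (nb i v)) ⟩
        d D i v xor δ nb p i v                           ≡⟨ cong (d D i v xor_) (coboundary (Flat-difference {D} {E} oddD oddE) vanishes i v) ⟨
        d D i v xor (d D i v xor d E i v)                ≡⟨ xor-cancelˡ (d D i v) (d E i v) ⟩
        d E i v                                          ∎
        where open ≡-Reasoning

  module Representatives {k} (dim : HasCodeDim A k) (D₀ : Dashing A) (odd₀ : IsOdd A D₀) where

    X : Characters k Code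
    X = characters k {Code} code? Code-closed (dim v₀)

    representative : Fin (2 ^ k) → Σ (Dashing A) (IsOdd A)
    representative j =
      twist D₀ (colourwise (char X j)) (Flat-colourwise (char X j)) , twist-odd {D₀} odd₀ (Flat-colourwise (char X j))

    holonomy-representative : ∀ j x →
      holonomy (d (proj₁ (representative j))) x ≡ holonomy (d D₀) x xor dot x (char X j)
    holonomy-representative j x =
      trans (sumAlong-⊕ₑ nb (d D₀) _ (word x) v₀) (cong (holonomy (d D₀) x xor_) (sumAlong-colourwise nb (char X j) x v₀))

    representatives-distinct : ∀ j j′ →
      SameClass A (proj₁ (representative j)) (proj₁ (representative j′)) → j ≡ j′
    representatives-distinct j j′ (g , switched , g≗) = distinct X j j′ dots-agree
      where
        same : ∀ x → Code x → holonomy (d (proj₁ (representative j))) x ≡ holonomy (d (proj₁ (representative j′))) x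
        same x cx = trans (sym (sumAlong-SwitchEquiv switched (word x) v₀ (trans (sym (walk-word nb x v₀)) cx)))
                          (sumAlong-cong nb g≗ (word x) v₀)
        dots-agree : ∀ x → Code x → dot x (char X j) ≡ dot x (char X j′)
        dots-agree x cx = begin
          dot x (char X j)                                      ≡⟨ xor-cancelˡ h₀ _ ⟨
          h₀ xor (h₀ xor dot x (char X j))                      ≡⟨ cong (h₀ xor_) (holonomy-representative j x) ⟨
          h₀ xor holonomy (d (proj₁ (representative j))) x      ≡⟨ cong (h₀ xor_) (same x cx) ⟩
          h₀ xor holonomy (d (proj₁ (representative j′))) x     ≡⟨ cong (h₀ xor_) (holonomy-representative j′ x) ⟩
          h₀ xor (h₀ xor dot x (char X j′))                     ≡⟨ xor-cancelˡ h₀ _ ⟩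
          dot x (char X j′)                                     ∎
          where
            open ≡-Reasoning
            h₀ = holonomy (d D₀) x

    representatives-cover : ∀ (D : Σ (Dashing A) (IsOdd A)) →
      ∃ λ j → SameClass A (proj₁ D) (proj₁ (representative j))
    representatives-cover (D , oddD) = j , SameClass-of-Vanishes {D} {R} oddD (proj₂ (representative j)) vanishes
      where
        φ = holonomy (d D ⊕ₑ d D₀)
        φ-additive : Additive Code φ
        φ-additive = holonomy-additive (Flat-difference {D} {D₀} oddD odd₀)
        j = proj₁ (complete X φ φ-additive)
        φ≡dot = proj₂ (complete X φ φ-additive)
        R = proj₁ (representative j)
        vanishes : Vanishes (d D ⊕ₑ d R)
        vanishes x cx = begin
          holonomy (d D ⊕ₑ d R) x                                        ≡⟨ sumAlong-⊕ₑ nb (d D) (d R) (word x) v₀ ⟩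
          holonomy (d D) x xor holonomy (d R) x                          ≡⟨ cong (holonomy (d D) x xor_) (holonomy-representative j x) ⟩
          holonomy (d D) x xor (holonomy (d D₀) x xor dot x (char X j))  ≡⟨ xor-assoc (holonomy (d D) x) _ _ ⟨
          (holonomy (d D) x xor holonomy (d D₀) x) xor dot x (char X j)
            ≡⟨ cong (_xor dot x (char X j)) (sumAlong-⊕ₑ nb (d D) (d D₀) (word x) v₀) ⟨
          φ x xor dot x (char X j)                                       ≡⟨ cong (_xor dot x (char X j)) (φ≡dot x cx) ⟩
          dot x (char X j) xor dot x (char X j)                          ≡⟨ xor-same (dot x (char X j)) ⟩
          false                                                          ∎
          where open ≡-Reasoning

mainTheorem12 : ∀ (n k m : ℕ) (A : Chromotopology n m) →
    HasCodeDim A k → Adinkraizable A → NumSwitchingClasses A (2 ^ k)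
mainTheorem12 n k zero    A _   _ with Chromotopology.nonempty A
... | ()
mainTheorem12 n k (suc m) A dim ((D₀ , odd₀) , _) =
  representative , representatives-cover , representatives-distinct
  where open Classification.Representatives A fzero {k} dim D₀ odd₀
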